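{- Let $\mathsf{M}$ be a matroid of rank $k$ with two distinct stressed hyperplanes $H_1$ and $H_2$. Then $|H_1\cap H_2|\leq k-2$.
   Context: A hyperplane of a matroid of rank $k$ is a flat of rank $k-1$; it is stressed if all its subsets of cardinality $k$ are circuits. -}

module Defs where

open import Data.Nat using (ℕ; _<_; _≤_; _∸_)
open import Data.Fin using (Fin)
open import Data.Fin.Subset using (Subset; _∈_; _∉_; _⊆_; _∪_; _-_; ⁅_⁆; ∣_∣; ⊥; ⊤)
open import Data.Product using (Σ; _×_; ∃)
open import Relation.Binary.PropositionalEquality using (_≡_)
open import Relation.Nullary using (¬_)
open import Relation.Unary using (Decidable)

record Matroid (n : ℕ) : Set₁ where
  field
    Indep      : Subset n → Set
    indep?     : Decidable Indep
    indep-⊥    : Indep ⊥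
    hereditary : ∀ {I J} → I ⊆ J → Indep J → Indep I
    augment    : ∀ {I J} → Indep I → Indep J → ∣ I ∣ < ∣ J ∣ →
                 Σ (Fin n) λ x → x ∈ J × x ∉ I × Indep (I ∪ ⁅ x ⁆)

module _ {n : ℕ} (M : Matroid n) where
  open Matroid M

  HasRank : Subset n → ℕ → Set
  HasRank A r =
    Σ (Subset n) (λ I → I ⊆ A × Indep I × ∣ I ∣ ≡ r)
    × (∀ J → J ⊆ A → Indep J → ∣ J ∣ ≤ r)

  RankOfMatroid : ℕ → Set
  RankOfMatroid k = HasRank ⊤ k

  Flat : Subset n → Set
  Flat F = ∀ x r r' → x ∉ F → HasRank F r → HasRank (F ∪ ⁅ x ⁆) r' → r < r'

  Circuit : Subset n → Set
  Circuit C = ¬ Indep C × (∀ x → x ∈ C → Indep (C - x))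

  Hyperplane : ℕ → Subset n → Set
  Hyperplane k H = Flat H × HasRank H (k ∸ 1)

  Stressed : ℕ → Subset n → Set
  Stressed k H = ∀ S → S ⊆ H → ∣ S ∣ ≡ k → Circuit S

{-# OPTIONS --safe #-}
-- Let the rank be k ≥ 1 and suppose H₁ ∩ H₂ contains a (k-1)-element set S.
-- For x ∈ H₂ outside S, the k-subset S ∪ {x} of the stressed H₂ is a circuit,
-- so S is independent and hence a basis of the hyperplane H₁ that stays
-- maximal in H₁ ∪ {x}. Thus x does not raise the rank of the flat H₁, i.e.
-- x ∈ H₁; so H₂ ⊆ H₁, symmetrically H₁ ⊆ H₂, contradicting H₁ ≠ H₂.
-- In rank 0 every flat is the whole ground set.
module Submission where

open import Defs
open import Data.Nat using (ℕ; zero; suc; _≤_; _<_; _∸_; s≤s; _≤?_)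
open import Data.Nat.Properties using (≤-trans; ≰⇒>; <-irrefl; m≤n+m∸n)
open import Data.Fin using (Fin; zero; suc)
open import Data.Fin.Subset
  using (Subset; inside; outside; _∈_; _∉_; _⊆_; _∩_; _∪_; _-_; ⁅_⁆; ∣_∣; ⊥)
open import Data.Fin.Subset.Properties
  using (_∈?_; ∉⊥; ∣⊥∣≡0; ⊆⊤; ⊆-antisym; x∈⁅x⁆; x∈⁅y⁆⇒x≡y;
         x∈p∪q⁻; p⊆p∪q; q⊆p∪q; x∈p∩q⁻; x∈p∧x≢y⇒x∈p-y; ∪-identityʳ)
open import Data.Vec using (_∷_; here; there)
open import Data.Product using (Σ; _×_; _,_; proj₁; proj₂)
open import Data.Sum using (inj₁; inj₂; [_,_])
open import Function using (_∘_)
open import Relation.Nullary using (¬_; yes; no; contradiction)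
open import Relation.Binary.PropositionalEquality
  using (_≡_; _≢_; refl; sym; trans; cong; subst)

∣p∪⁅x⁆∣≡1+∣p∣ : ∀ {n} (p : Subset n) {x : Fin n} → x ∉ p → ∣ p ∪ ⁅ x ⁆ ∣ ≡ suc ∣ p ∣
∣p∪⁅x⁆∣≡1+∣p∣ (inside  ∷ p) {zero}  x∉p = contradiction here x∉p
∣p∪⁅x⁆∣≡1+∣p∣ (outside ∷ p) {zero}  x∉p = cong (suc ∘ ∣_∣) (∪-identityʳ p)
∣p∪⁅x⁆∣≡1+∣p∣ (inside  ∷ p) {suc x} x∉p = cong suc (∣p∪⁅x⁆∣≡1+∣p∣ p (x∉p ∘ there))
∣p∪⁅x⁆∣≡1+∣p∣ (outside ∷ p) {suc x} x∉p = ∣p∪⁅x⁆∣≡1+∣p∣ p (x∉p ∘ there)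

∃-⊆-of-size : ∀ {n} (p : Subset n) {m : ℕ} → m ≤ ∣ p ∣ →
              Σ (Subset n) λ q → q ⊆ p × ∣ q ∣ ≡ m
∃-⊆-of-size {n} p {zero} _ = ⊥ , (λ x∈⊥ → contradiction x∈⊥ ∉⊥) , ∣⊥∣≡0 n
∃-⊆-of-size (outside ∷ p) {suc m} m<∣p∣ with ∃-⊆-of-size p m<∣p∣
... | q , q⊆p , ∣q∣≡1+m = outside ∷ q , (λ { (there x∈q) → there (q⊆p x∈q) }) , ∣q∣≡1+m
∃-⊆-of-size (inside ∷ p) {suc m} (s≤s m≤∣p∣) with ∃-⊆-of-size p m≤∣p∣
... | q , q⊆p , ∣q∣≡m = inside ∷ q , (λ { here → here ; (there x∈q) → there (q⊆p x∈q) })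
                                   , cong suc ∣q∣≡m


p⊆r∧x∈r⇒p∪⁅x⁆⊆r : ∀ {n} {p r : Subset n} {x : Fin n} → p ⊆ r → x ∈ r → p ∪ ⁅ x ⁆ ⊆ r
p⊆r∧x∈r⇒p∪⁅x⁆⊆r {p = p} {x = x} p⊆r x∈r y∈p∪⁅x⁆ =
  [ p⊆r , (λ y∈⁅x⁆ → subst (_∈ _) (sym (x∈⁅y⁆⇒x≡y x y∈⁅x⁆)) x∈r) ] (x∈p∪q⁻ p ⁅ x ⁆ y∈p∪⁅x⁆)

module _ {n : ℕ} (M : Matroid n) where
  open Matroid M

  circuit-∪⁅x⁆⇒indep : ∀ {S x} → x ∉ S → Circuit M (S ∪ ⁅ x ⁆) → Indep S
  circuit-∪⁅x⁆⇒indep {S} {x} x∉S (_ , minimal) =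
    hereditary S⊆S∪⁅x⁆-x (minimal x (q⊆p∪q S ⁅ x ⁆ (x∈⁅x⁆ x)))
    where
    S⊆S∪⁅x⁆-x : S ⊆ (S ∪ ⁅ x ⁆) - x
    S⊆S∪⁅x⁆-x y∈S = x∈p∧x≢y⇒x∈p-y (p⊆p∪q ⁅ x ⁆ y∈S) (λ { refl → x∉S y∈S })

  -- A basis S of A which cannot be extended by x is still a basis of A ∪ {x}:
  -- a larger independent set would, by augmentation, extend S inside A or by x.
  maximal-basis⇒rank-∪⁅x⁆ : ∀ {A S x r} → HasRank M A r →
    S ⊆ A → Indep S → ∣ S ∣ ≡ r → ¬ Indep (S ∪ ⁅ x ⁆) → HasRank M (A ∪ ⁅ x ⁆) r
  maximal-basis⇒rank-∪⁅x⁆ {A} {S} {x} {r} (_ , bounded) S⊆A indS ∣S∣≡r S∪⁅x⁆-dep =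
    (S , p⊆p∪q ⁅ x ⁆ ∘ S⊆A , indS , ∣S∣≡r) , bounded′
    where
    bounded′ : ∀ J → J ⊆ A ∪ ⁅ x ⁆ → Indep J → ∣ J ∣ ≤ r
    bounded′ J J⊆A∪⁅x⁆ indJ with ∣ J ∣ ≤? r
    ... | yes ∣J∣≤r = ∣J∣≤r
    ... | no ∣J∣≰r with augment indS indJ (subst (_< ∣ J ∣) (sym ∣S∣≡r) (≰⇒> ∣J∣≰r))
    ...   | y , y∈J , y∉S , indS∪⁅y⁆ with x∈p∪q⁻ A ⁅ x ⁆ (J⊆A∪⁅x⁆ y∈J)
    ...     | inj₂ y∈⁅x⁆ rewrite x∈⁅y⁆⇒x≡y x y∈⁅x⁆ = contradiction indS∪⁅y⁆ S∪⁅x⁆-dep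
    ...     | inj₁ y∈A = contradiction (bounded (S ∪ ⁅ y ⁆) (p⊆r∧x∈r⇒p∪⁅x⁆⊆r S⊆A y∈A) indS∪⁅y⁆)
                                       (λ ∣S∪⁅y⁆∣≤r → <-irrefl refl (subst (_≤ r) ∣S∪⁅y⁆∣≡1+r ∣S∪⁅y⁆∣≤r))
      where
      ∣S∪⁅y⁆∣≡1+r : ∣ S ∪ ⁅ y ⁆ ∣ ≡ suc r
      ∣S∪⁅y⁆∣≡1+r = trans (∣p∪⁅x⁆∣≡1+∣p∣ S y∉S) (cong suc ∣S∣≡r)

  flat-closed : ∀ {F x r} → Flat M F → HasRank M F r → HasRank M (F ∪ ⁅ x ⁆) r → x ∈ F
  flat-closed {F} {x} {r} flat rankF rankF∪⁅x⁆ with x ∈? F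
  ... | yes x∈F = x∈F
  ... | no  x∉F = contradiction (flat x r r x∉F rankF rankF∪⁅x⁆) (<-irrefl refl)

  rank-zero⇒⊤⊆flat : ∀ {F} → RankOfMatroid M 0 → Flat M F → HasRank M F 0 → ∀ x → x ∈ F
  rank-zero⇒⊤⊆flat (_ , bounded) flat rankF@((I , I⊆F , indI , ∣I∣≡0) , _) x =
    flat-closed flat rankF ((I , p⊆p∪q ⁅ x ⁆ ∘ I⊆F , indI , ∣I∣≡0) , λ J _ → bounded J ⊆⊤)

  stressed⊆hyperplane : ∀ {k H H′ S} → Hyperplane M (suc k) H → Stressed M (suc k) H′ →
    S ⊆ H → S ⊆ H′ → ∣ S ∣ ≡ k → H′ ⊆ H
  stressed⊆hyperplane {S = S} (flat , rankH) stressed S⊆H S⊆H′ ∣S∣≡k {x} x∈H′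
    with x ∈? S
  ... | yes x∈S = S⊆H x∈S
  ... | no  x∉S = flat-closed flat rankH
        (maximal-basis⇒rank-∪⁅x⁆ rankH S⊆H (circuit-∪⁅x⁆⇒indep x∉S circuit) ∣S∣≡k (proj₁ circuit))
    where
    circuit : Circuit M (S ∪ ⁅ x ⁆)
    circuit = stressed (S ∪ ⁅ x ⁆) (p⊆r∧x∈r⇒p∪⁅x⁆⊆r S⊆H′ x∈H′)
                       (trans (∣p∪⁅x⁆∣≡1+∣p∣ S x∉S) (cong suc ∣S∣≡k))

proposition3p8 : ∀ {n : ℕ} (M : Matroid n) (k : ℕ) → RankOfMatroid M k →
                 (H₁ H₂ : Subset n) → H₁ ≢ H₂ →
                 Hyperplane M k H₁ → Stressed M k H₁ →
                 Hyperplane M k H₂ → Stressed M k H₂ →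
                 ∣ H₁ ∩ H₂ ∣ ≤ k ∸ 2
proposition3p8 M zero rankM H₁ H₂ H₁≢H₂ (flat₁ , rank₁) _ (flat₂ , rank₂) _ =
  contradiction (⊆-antisym (λ {x} _ → rank-zero⇒⊤⊆flat M rankM flat₂ rank₂ x)
                           (λ {x} _ → rank-zero⇒⊤⊆flat M rankM flat₁ rank₁ x)) H₁≢H₂
proposition3p8 M (suc k) _ H₁ H₂ H₁≢H₂ hyp₁ stressed₁ hyp₂ stressed₂
  with ∣ H₁ ∩ H₂ ∣ ≤? k ∸ 1
... | yes small = small
... | no ∣H₁∩H₂∣≰k-1 with ∃-⊆-of-size (H₁ ∩ H₂) (≤-trans (m≤n+m∸n k 1) (≰⇒> ∣H₁∩H₂∣≰k-1))
... | S , S⊆H₁∩H₂ , ∣S∣≡k = contradiction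
  (⊆-antisym (stressed⊆hyperplane M hyp₂ stressed₁ S⊆H₂ S⊆H₁ ∣S∣≡k)
             (stressed⊆hyperplane M hyp₁ stressed₂ S⊆H₁ S⊆H₂ ∣S∣≡k)) H₁≢H₂
  where
  S⊆H₁ : S ⊆ H₁
  S⊆H₁ = proj₁ ∘ x∈p∩q⁻ H₁ H₂ ∘ S⊆H₁∩H₂
  S⊆H₂ : S ⊆ H₂
  S⊆H₂ = proj₂ ∘ x∈p∩q⁻ H₁ H₂ ∘ S⊆H₁∩H₂
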